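{- For any functional Pure Type System $P$, the reduction relation $\longrightarrow$ of $\lambda\Pi_P$ is confluent: for all terms $M,M',M''$, if $M\longrightarrow^* M'$ and $M\longrightarrow^* M''$ then there is a term $N$ with $M'\longrightarrow^* N$ and $M''\longrightarrow^* N$.
   Context: A Pure Type System $P=\langle S,A,R\rangle$ has sorts $S$, axioms $A\subseteq S\times S$, rules $R\subseteq S\times S\times S$; it is functional if $\langle s_1,s_2\rangle,\langle s_1,s_3\rangle\in A$ implies $s_2=s_3$ and $\langle s_1,s_2,s_3\rangle,\langle s_1,s_2,s_4\rangle\in R$ implies $s_3=s_4$. Terms of $\lambda\Pi_P$: $t::=x\mid Type\mid Kind\mid \Pi x:t~t\mid\lambda x:t~t\mid t~t$, where the variables include the constants $U_s,\varepsilon_s$ ($s\in S$), $\dot{s_1}$ ($\langle s_1,s_2\rangle\in A$), $\dot\Pi_{\langle s_1,s_2,s_3\rangle}$ ($\langle s_1,s_2,s_3\rangle\in R$). The relation $\longrightarrow$ is the compatible closure (one step, anywhere in a term) of $\beta$-reduction $(\lambda x:A~M)~N\longrightarrow (N/x)M$ together with the rewrite rules $\varepsilon_{s_2}~\dot{s_1}\longrightarrow U_{s_1}$ for $\langle s_1,s_2\rangle\in A$ and $\varepsilon_{s_3}(\dot\Pi_{\langle s_1,s_2,s_3\rangle}~X~Y)\longrightarrow \Pi x:(\varepsilon_{s_1}~X)~(\varepsilon_{s_2}~(Y~x))$ for $\langle s_1,s_2,s_3\rangle\in R$ and arbitrary terms $X,Y$. -}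

module Defs where

open import Data.Nat using (ℕ; zero; suc)
open import Data.Product using (_×_)
open import Relation.Binary.PropositionalEquality using (_≡_)
open import Relation.Binary.Construct.Closure.ReflexiveTransitive using (Star)

record PTS : Set₁ where
  field
    Sort : Set
    Ax   : Sort → Sort → Set
    Rl   : Sort → Sort → Sort → Set

Functional : PTS → Set
Functional P =
  (∀ {s₁ s₂ s₃} → Ax s₁ s₂ → Ax s₁ s₃ → s₂ ≡ s₃) ×
  (∀ {s₁ s₂ s₃ s₄} → Rl s₁ s₂ s₃ → Rl s₁ s₂ s₄ → s₃ ≡ s₄)
  where open PTS P

module LambdaPi (P : PTS) where
  open PTS P

  -- Terms of λΠ_P, variables as de Bruijn indices; the constants
  -- U_s, ε_s (s ∈ S), ṡ₁ (⟨s₁,s₂⟩ ∈ A), Π̇_⟨s₁,s₂,s₃⟩ (⟨s₁,s₂,s₃⟩ ∈ R)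
  -- are separate constructors.  Π and λ bind index 0 in their body.
  data Term : Set where
    var  : ℕ → Term
    Type : Term
    Kind : Term
    U    : Sort → Term
    ε    : Sort → Term
    dot  : (s₁ s₂ : Sort) → Ax s₁ s₂ → Term
    Πdot : (s₁ s₂ s₃ : Sort) → Rl s₁ s₂ s₃ → Term
    Π    : Term → Term → Term
    lam  : Term → Term → Term
    app  : Term → Term → Term

  ext : (ℕ → ℕ) → ℕ → ℕ
  ext ρ zero    = zero
  ext ρ (suc n) = suc (ρ n)

  rename : (ℕ → ℕ) → Term → Term
  rename ρ (var x)        = var (ρ x)
  rename ρ Type           = Type
  rename ρ Kind           = Kind
  rename ρ (U s)          = U s
  rename ρ (ε s)          = ε s
  rename ρ (dot s₁ s₂ p)  = dot s₁ s₂ p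
  rename ρ (Πdot a b c p) = Πdot a b c p
  rename ρ (Π A B)        = Π (rename ρ A) (rename (ext ρ) B)
  rename ρ (lam A M)      = lam (rename ρ A) (rename (ext ρ) M)
  rename ρ (app M N)      = app (rename ρ M) (rename ρ N)

  weaken : Term → Term
  weaken = rename suc

  exts : (ℕ → Term) → ℕ → Term
  exts σ zero    = var zero
  exts σ (suc n) = weaken (σ n)

  subst : (ℕ → Term) → Term → Term
  subst σ (var x)        = σ x
  subst σ Type           = Type
  subst σ Kind           = Kind
  subst σ (U s)          = U s
  subst σ (ε s)          = ε s
  subst σ (dot s₁ s₂ p)  = dot s₁ s₂ p
  subst σ (Πdot a b c p) = Πdot a b c p
  subst σ (Π A B)        = Π (subst σ A) (subst (exts σ) B)
  subst σ (lam A M)      = lam (subst σ A) (subst (exts σ) M)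
  subst σ (app M N)      = app (subst σ M) (subst σ N)

  sub0 : Term → ℕ → Term
  sub0 N zero    = N
  sub0 N (suc n) = var n

  _[_] : Term → Term → Term
  M [ N ] = subst (sub0 N) M

  data _⟶_ : Term → Term → Set where
    β     : ∀ A M N → app (lam A M) N ⟶ (M [ N ])
    εdot  : ∀ s₁ s₂ (p : Ax s₁ s₂) → app (ε s₂) (dot s₁ s₂ p) ⟶ U s₁
    εΠdot : ∀ s₁ s₂ s₃ (p : Rl s₁ s₂ s₃) X Y →
            app (ε s₃) (app (app (Πdot s₁ s₂ s₃ p) X) Y) ⟶
            Π (app (ε s₁) X) (app (ε s₂) (app (weaken Y) (var zero)))
    Πˡ    : ∀ {A A'} B → A ⟶ A' → Π A B ⟶ Π A' B
    Πʳ    : ∀ A {B B'} → B ⟶ B' → Π A B ⟶ Π A B'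
    lamˡ  : ∀ {A A'} M → A ⟶ A' → lam A M ⟶ lam A' M
    lamʳ  : ∀ A {M M'} → M ⟶ M' → lam A M ⟶ lam A M'
    appˡ  : ∀ {M M'} N → M ⟶ M' → app M N ⟶ app M' N
    appʳ  : ∀ M {N N'} → N ⟶ N' → app M N ⟶ app M N'

  _⟶*_ : Term → Term → Set
  _⟶*_ = Star _⟶_

{-# OPTIONS --safe #-}
-- Tait–Martin-Löf: parallel reduction ⇛, contracting any set of redexes at
-- once, satisfies ⟶ ⊆ ⇛ ⊆ ⟶*, so ⟶* is also the reflexive–transitive
-- closure of ⇛.  The rewrite rules are left-linear and do not overlap each
-- other or β, so ⇛ has the diamond property, which lifts to its closure.
module Submission where

open import Defs
open import Level using (_⊔_)
open import Data.Nat using (ℕ; zero; suc)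
open import Data.Product using (Σ; ∃; _×_; _,_)
open import Relation.Binary.Core using (Rel; _⇒_)
open import Relation.Binary.PropositionalEquality
  using (_≡_; refl; sym; trans; cong; cong₂)
  renaming (subst to transport)
open import Relation.Binary.Construct.Closure.ReflexiveTransitive
  using (Star; _◅_; _◅◅_; gmap; map; return; _⋆) renaming (ε to ◅-nil)
open import Relation.Binary.Rewriting using (Confluent)

Diamond : ∀ {a ℓ} {A : Set a} → Rel A ℓ → Set (a ⊔ ℓ)
Diamond _⇛_ = ∀ {M N₁ N₂} → M ⇛ N₁ → M ⇛ N₂ → ∃ λ N → (N₁ ⇛ N) × (N₂ ⇛ N)

module _ {a ℓ} {A : Set a} {_⇛_ : Rel A ℓ} (diamond : Diamond _⇛_) where

  diamond-strip : ∀ {M N₁ N₂} → M ⇛ N₁ → Star _⇛_ M N₂ →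
                  ∃ λ N → Star _⇛_ N₁ N × (N₂ ⇛ N)
  diamond-strip d ◅-nil = _ , ◅-nil , d
  diamond-strip d (e ◅ es) with diamond d e
  ... | _ , d₁ , e₁ with diamond-strip e₁ es
  ...   | _ , ds , d₂ = _ , d₁ ◅ ds , d₂

  diamond⇒confluent : Confluent _⇛_
  diamond⇒confluent ◅-nil es = _ , es , ◅-nil
  diamond⇒confluent (d ◅ ds) es with diamond-strip d es
  ... | _ , es₁ , d₁ with diamond⇒confluent ds es₁
  ...   | _ , ds₂ , es₂ = _ , ds₂ , d₁ ◅ es₂

module _ {a ℓ₁ ℓ₂} {A : Set a} {_⟶_ : Rel A ℓ₁} {_⇛_ : Rel A ℓ₂} where

  confluent-via-diamond : _⟶_ ⇒ _⇛_ → _⇛_ ⇒ Star _⟶_ → Diamond _⇛_ →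
                          Confluent _⟶_
  confluent-via-diamond ⟶⊆⇛ ⇛⊆⟶* diamond r₁ r₂
    with diamond⇒confluent diamond (map ⟶⊆⇛ r₁) (map ⟶⊆⇛ r₂)
  ... | N , s₁ , s₂ = N , (⇛⊆⟶* ⋆) s₁ , (⇛⊆⟶* ⋆) s₂

module Confluence (P : PTS) where
  open PTS P
  open LambdaPi P

  ext-∘ : ∀ {ρ ρ' ρ''} → (∀ x → ρ (ρ' x) ≡ ρ'' x) →
          ∀ x → ext ρ (ext ρ' x) ≡ ext ρ'' x
  ext-∘ h zero    = refl
  ext-∘ h (suc x) = cong suc (h x)

  rename-rename : ∀ {ρ ρ' ρ''} → (∀ x → ρ (ρ' x) ≡ ρ'' x) →
                  ∀ M → rename ρ (rename ρ' M) ≡ rename ρ'' M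
  rename-rename h (var x)        = cong var (h x)
  rename-rename h Type           = refl
  rename-rename h Kind           = refl
  rename-rename h (U s)          = refl
  rename-rename h (ε s)          = refl
  rename-rename h (dot s₁ s₂ p)  = refl
  rename-rename h (Πdot a b c p) = refl
  rename-rename h (Π A B)   = cong₂ Π (rename-rename h A) (rename-rename (ext-∘ h) B)
  rename-rename h (lam A M) = cong₂ lam (rename-rename h A) (rename-rename (ext-∘ h) M)
  rename-rename h (app M N) = cong₂ app (rename-rename h M) (rename-rename h N)

  rename-ext-weaken : ∀ ρ M → rename (ext ρ) (weaken M) ≡ weaken (rename ρ M)
  rename-ext-weaken ρ M =
    trans (rename-rename (λ _ → refl) M) (sym (rename-rename (λ _ → refl) M))

  rename-exts : ∀ {ρ σ σ'} → (∀ x → rename ρ (σ x) ≡ σ' x) →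
                ∀ x → rename (ext ρ) (exts σ x) ≡ exts σ' x
  rename-exts h zero            = refl
  rename-exts {ρ} {σ} h (suc x) = trans (rename-ext-weaken ρ (σ x)) (cong weaken (h x))

  rename-subst : ∀ {ρ σ σ'} → (∀ x → rename ρ (σ x) ≡ σ' x) →
                 ∀ M → rename ρ (subst σ M) ≡ subst σ' M
  rename-subst h (var x)        = h x
  rename-subst h Type           = refl
  rename-subst h Kind           = refl
  rename-subst h (U s)          = refl
  rename-subst h (ε s)          = refl
  rename-subst h (dot s₁ s₂ p)  = refl
  rename-subst h (Πdot a b c p) = refl
  rename-subst h (Π A B)   = cong₂ Π (rename-subst h A) (rename-subst (rename-exts h) B)
  rename-subst h (lam A M) = cong₂ lam (rename-subst h A) (rename-subst (rename-exts h) M)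
  rename-subst h (app M N) = cong₂ app (rename-subst h M) (rename-subst h N)

  exts-ext : ∀ {σ ρ σ'} → (∀ x → σ (ρ x) ≡ σ' x) →
             ∀ x → exts σ (ext ρ x) ≡ exts σ' x
  exts-ext h zero    = refl
  exts-ext h (suc x) = cong weaken (h x)

  subst-rename : ∀ {σ ρ σ'} → (∀ x → σ (ρ x) ≡ σ' x) →
                 ∀ M → subst σ (rename ρ M) ≡ subst σ' M
  subst-rename h (var x)        = h x
  subst-rename h Type           = refl
  subst-rename h Kind           = refl
  subst-rename h (U s)          = refl
  subst-rename h (ε s)          = refl
  subst-rename h (dot s₁ s₂ p)  = refl
  subst-rename h (Πdot a b c p) = refl
  subst-rename h (Π A B)   = cong₂ Π (subst-rename h A) (subst-rename (exts-ext h) B)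
  subst-rename h (lam A M) = cong₂ lam (subst-rename h A) (subst-rename (exts-ext h) M)
  subst-rename h (app M N) = cong₂ app (subst-rename h M) (subst-rename h N)

  subst-exts-weaken : ∀ σ M → subst (exts σ) (weaken M) ≡ weaken (subst σ M)
  subst-exts-weaken σ M =
    trans (subst-rename (λ _ → refl) M) (sym (rename-subst (λ _ → refl) M))

  subst-exts : ∀ {σ τ υ} → (∀ x → subst σ (τ x) ≡ υ x) →
               ∀ x → subst (exts σ) (exts τ x) ≡ exts υ x
  subst-exts h zero            = refl
  subst-exts {σ} {τ} h (suc x) = trans (subst-exts-weaken σ (τ x)) (cong weaken (h x))

  subst-subst : ∀ {σ τ υ} → (∀ x → subst σ (τ x) ≡ υ x) →
                ∀ M → subst σ (subst τ M) ≡ subst υ M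
  subst-subst h (var x)        = h x
  subst-subst h Type           = refl
  subst-subst h Kind           = refl
  subst-subst h (U s)          = refl
  subst-subst h (ε s)          = refl
  subst-subst h (dot s₁ s₂ p)  = refl
  subst-subst h (Πdot a b c p) = refl
  subst-subst h (Π A B)   = cong₂ Π (subst-subst h A) (subst-subst (subst-exts h) B)
  subst-subst h (lam A M) = cong₂ lam (subst-subst h A) (subst-subst (subst-exts h) M)
  subst-subst h (app M N) = cong₂ app (subst-subst h M) (subst-subst h N)

  exts-var : ∀ {σ} → (∀ x → σ x ≡ var x) → ∀ x → exts σ x ≡ var x
  exts-var h zero    = refl
  exts-var h (suc x) = cong weaken (h x)

  subst-var : ∀ {σ} → (∀ x → σ x ≡ var x) → ∀ M → subst σ M ≡ M
  subst-var h (var x)        = h x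
  subst-var h Type           = refl
  subst-var h Kind           = refl
  subst-var h (U s)          = refl
  subst-var h (ε s)          = refl
  subst-var h (dot s₁ s₂ p)  = refl
  subst-var h (Πdot a b c p) = refl
  subst-var h (Π A B)   = cong₂ Π (subst-var h A) (subst-var (exts-var h) B)
  subst-var h (lam A M) = cong₂ lam (subst-var h A) (subst-var (exts-var h) M)
  subst-var h (app M N) = cong₂ app (subst-var h M) (subst-var h N)

  weaken-[] : ∀ M N → weaken M [ N ] ≡ M
  weaken-[] M N = trans (subst-rename (λ _ → refl) M) (subst-var (λ _ → refl) M)

  rename-[] : ∀ ρ M N → rename (ext ρ) M [ rename ρ N ] ≡ rename ρ (M [ N ])
  rename-[] ρ M N = trans (subst-rename sub0-ext M) (sym (rename-subst (λ _ → refl) M))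
    where
    sub0-ext : ∀ x → sub0 (rename ρ N) (ext ρ x) ≡ rename ρ (sub0 N x)
    sub0-ext zero    = refl
    sub0-ext (suc x) = refl

  subst-[] : ∀ σ M N → subst (exts σ) M [ subst σ N ] ≡ subst σ (M [ N ])
  subst-[] σ M N = trans (subst-subst sub0-exts M) (sym (subst-subst (λ _ → refl) M))
    where
    sub0-exts : ∀ x → exts σ x [ subst σ N ] ≡ subst σ (sub0 N x)
    sub0-exts zero    = refl
    sub0-exts (suc x) = weaken-[] (σ x) (subst σ N)

  Πε : Sort → Sort → Term → Term → Term
  Πε s₁ s₂ X Y = Π (app (ε s₁) X) (app (ε s₂) (app (weaken Y) (var zero)))

  infix 4 _⇛_
  data _⇛_ : Term → Term → Set where
    ⇛-var   : ∀ x → var x ⇛ var x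
    ⇛-Type  : Type ⇛ Type
    ⇛-Kind  : Kind ⇛ Kind
    ⇛-U     : ∀ s → U s ⇛ U s
    ⇛-ε     : ∀ s → ε s ⇛ ε s
    ⇛-dot   : ∀ s₁ s₂ p → dot s₁ s₂ p ⇛ dot s₁ s₂ p
    ⇛-Πdot  : ∀ s₁ s₂ s₃ p → Πdot s₁ s₂ s₃ p ⇛ Πdot s₁ s₂ s₃ p
    ⇛-Π     : ∀ {A A' B B'} → A ⇛ A' → B ⇛ B' → Π A B ⇛ Π A' B'
    ⇛-lam   : ∀ {A A' M M'} → A ⇛ A' → M ⇛ M' → lam A M ⇛ lam A' M'
    ⇛-app   : ∀ {M M' N N'} → M ⇛ M' → N ⇛ N' → app M N ⇛ app M' N'
    ⇛-β     : ∀ {A M M' N N'} → M ⇛ M' → N ⇛ N' → app (lam A M) N ⇛ M' [ N' ]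
    ⇛-εdot  : ∀ s₁ s₂ (p : Ax s₁ s₂) → app (ε s₂) (dot s₁ s₂ p) ⇛ U s₁
    ⇛-εΠdot : ∀ s₁ s₂ s₃ (p : Rl s₁ s₂ s₃) {X X' Y Y'} → X ⇛ X' → Y ⇛ Y' →
              app (ε s₃) (app (app (Πdot s₁ s₂ s₃ p) X) Y) ⇛ Πε s₁ s₂ X' Y'

  ⇛-refl : ∀ M → M ⇛ M
  ⇛-refl (var x)        = ⇛-var x
  ⇛-refl Type           = ⇛-Type
  ⇛-refl Kind           = ⇛-Kind
  ⇛-refl (U s)          = ⇛-U s
  ⇛-refl (ε s)          = ⇛-ε s
  ⇛-refl (dot s₁ s₂ p)  = ⇛-dot s₁ s₂ p
  ⇛-refl (Πdot a b c p) = ⇛-Πdot a b c p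
  ⇛-refl (Π A B)        = ⇛-Π (⇛-refl A) (⇛-refl B)
  ⇛-refl (lam A M)      = ⇛-lam (⇛-refl A) (⇛-refl M)
  ⇛-refl (app M N)      = ⇛-app (⇛-refl M) (⇛-refl N)

  ⇛-rename : ∀ ρ {M M'} → M ⇛ M' → rename ρ M ⇛ rename ρ M'
  ⇛-rename ρ (⇛-var x)          = ⇛-var (ρ x)
  ⇛-rename ρ ⇛-Type             = ⇛-Type
  ⇛-rename ρ ⇛-Kind             = ⇛-Kind
  ⇛-rename ρ (⇛-U s)            = ⇛-U s
  ⇛-rename ρ (⇛-ε s)            = ⇛-ε s
  ⇛-rename ρ (⇛-dot s₁ s₂ p)    = ⇛-dot s₁ s₂ p
  ⇛-rename ρ (⇛-Πdot a b c p)   = ⇛-Πdot a b c p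
  ⇛-rename ρ (⇛-Π a b)          = ⇛-Π (⇛-rename ρ a) (⇛-rename (ext ρ) b)
  ⇛-rename ρ (⇛-lam a m)        = ⇛-lam (⇛-rename ρ a) (⇛-rename (ext ρ) m)
  ⇛-rename ρ (⇛-app m n)        = ⇛-app (⇛-rename ρ m) (⇛-rename ρ n)
  ⇛-rename ρ (⇛-β {M' = M'} {N' = N'} m n) =
    transport (_ ⇛_) (rename-[] ρ M' N') (⇛-β (⇛-rename (ext ρ) m) (⇛-rename ρ n))
  ⇛-rename ρ (⇛-εdot s₁ s₂ p)   = ⇛-εdot s₁ s₂ p
  ⇛-rename ρ (⇛-εΠdot s₁ s₂ s₃ p {Y' = Y'} x y) =
    transport (λ t → _ ⇛ Π _ (app (ε s₂) (app t (var zero))))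
      (sym (rename-ext-weaken ρ Y')) (⇛-εΠdot s₁ s₂ s₃ p (⇛-rename ρ x) (⇛-rename ρ y))

  ⇛-Πε : ∀ s₁ s₂ {X X' Y Y'} → X ⇛ X' → Y ⇛ Y' → Πε s₁ s₂ X Y ⇛ Πε s₁ s₂ X' Y'
  ⇛-Πε s₁ s₂ x y =
    ⇛-Π (⇛-app (⇛-ε s₁) x) (⇛-app (⇛-ε s₂) (⇛-app (⇛-rename suc y) (⇛-var zero)))

  _⇛ˢ_ : (ℕ → Term) → (ℕ → Term) → Set
  σ ⇛ˢ τ = ∀ x → σ x ⇛ τ x

  ⇛ˢ-exts : ∀ {σ τ} → σ ⇛ˢ τ → exts σ ⇛ˢ exts τ
  ⇛ˢ-exts h zero    = ⇛-var zero
  ⇛ˢ-exts h (suc x) = ⇛-rename suc (h x)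

  ⇛-subst : ∀ {σ τ M M'} → σ ⇛ˢ τ → M ⇛ M' → subst σ M ⇛ subst τ M'
  ⇛-subst h (⇛-var x)        = h x
  ⇛-subst h ⇛-Type           = ⇛-Type
  ⇛-subst h ⇛-Kind           = ⇛-Kind
  ⇛-subst h (⇛-U s)          = ⇛-U s
  ⇛-subst h (⇛-ε s)          = ⇛-ε s
  ⇛-subst h (⇛-dot s₁ s₂ p)  = ⇛-dot s₁ s₂ p
  ⇛-subst h (⇛-Πdot a b c p) = ⇛-Πdot a b c p
  ⇛-subst h (⇛-Π a b)        = ⇛-Π (⇛-subst h a) (⇛-subst (⇛ˢ-exts h) b)
  ⇛-subst h (⇛-lam a m)      = ⇛-lam (⇛-subst h a) (⇛-subst (⇛ˢ-exts h) m)
  ⇛-subst h (⇛-app m n)      = ⇛-app (⇛-subst h m) (⇛-subst h n)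
  ⇛-subst {τ = τ} h (⇛-β {M' = M'} {N' = N'} m n) =
    transport (_ ⇛_) (subst-[] τ M' N') (⇛-β (⇛-subst (⇛ˢ-exts h) m) (⇛-subst h n))
  ⇛-subst h (⇛-εdot s₁ s₂ p) = ⇛-εdot s₁ s₂ p
  ⇛-subst {τ = τ} h (⇛-εΠdot s₁ s₂ s₃ p {Y' = Y'} x y) =
    transport (λ t → _ ⇛ Π _ (app (ε s₂) (app t (var zero))))
      (sym (subst-exts-weaken τ Y')) (⇛-εΠdot s₁ s₂ s₃ p (⇛-subst h x) (⇛-subst h y))

  ⇛-[] : ∀ {M M' N N'} → M ⇛ M' → N ⇛ N' → M [ N ] ⇛ M' [ N' ]
  ⇛-[] {N = N} {N'} m n = ⇛-subst ⇛ˢ-sub0 m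
    where
    ⇛ˢ-sub0 : sub0 N ⇛ˢ sub0 N'
    ⇛ˢ-sub0 zero    = n
    ⇛ˢ-sub0 (suc x) = ⇛-var x

  ⇛-diamond : Diamond _⇛_
  ⇛-diamond (⇛-var x) (⇛-var .x)                   = _ , ⇛-var x , ⇛-var x
  ⇛-diamond ⇛-Type ⇛-Type                          = _ , ⇛-Type , ⇛-Type
  ⇛-diamond ⇛-Kind ⇛-Kind                          = _ , ⇛-Kind , ⇛-Kind
  ⇛-diamond (⇛-U s) (⇛-U .s)                       = _ , ⇛-U s , ⇛-U s
  ⇛-diamond (⇛-ε s) (⇛-ε .s)                       = _ , ⇛-ε s , ⇛-ε s
  ⇛-diamond (⇛-dot a b p) (⇛-dot .a .b .p)         = _ , ⇛-dot a b p , ⇛-dot a b p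
  ⇛-diamond (⇛-Πdot a b c p) (⇛-Πdot .a .b .c .p)  = _ , ⇛-Πdot a b c p , ⇛-Πdot a b c p
  ⇛-diamond (⇛-Π a b) (⇛-Π a' b') with ⇛-diamond a a' | ⇛-diamond b b'
  ... | _ , a₁ , a₂ | _ , b₁ , b₂ = _ , ⇛-Π a₁ b₁ , ⇛-Π a₂ b₂
  ⇛-diamond (⇛-lam a m) (⇛-lam a' m') with ⇛-diamond a a' | ⇛-diamond m m'
  ... | _ , a₁ , a₂ | _ , m₁ , m₂ = _ , ⇛-lam a₁ m₁ , ⇛-lam a₂ m₂
  ⇛-diamond (⇛-app m n) (⇛-app m' n') with ⇛-diamond m m' | ⇛-diamond n n'
  ... | _ , m₁ , m₂ | _ , n₁ , n₂ = _ , ⇛-app m₁ n₁ , ⇛-app m₂ n₂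
  ⇛-diamond (⇛-app (⇛-lam _ m) n) (⇛-β m' n') with ⇛-diamond m m' | ⇛-diamond n n'
  ... | _ , m₁ , m₂ | _ , n₁ , n₂ = _ , ⇛-β m₁ n₁ , ⇛-[] m₂ n₂
  ⇛-diamond (⇛-β m n) (⇛-app (⇛-lam _ m') n') with ⇛-diamond m m' | ⇛-diamond n n'
  ... | _ , m₁ , m₂ | _ , n₁ , n₂ = _ , ⇛-[] m₁ n₁ , ⇛-β m₂ n₂
  ⇛-diamond (⇛-β m n) (⇛-β m' n') with ⇛-diamond m m' | ⇛-diamond n n'
  ... | _ , m₁ , m₂ | _ , n₁ , n₂ = _ , ⇛-[] m₁ n₁ , ⇛-[] m₂ n₂
  ⇛-diamond (⇛-app (⇛-ε _) (⇛-dot a b p)) (⇛-εdot .a .b .p) = _ , ⇛-εdot a b p , ⇛-U a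
  ⇛-diamond (⇛-εdot a b p) (⇛-app (⇛-ε _) (⇛-dot .a .b .p)) = _ , ⇛-U a , ⇛-εdot a b p
  ⇛-diamond (⇛-εdot a b p) (⇛-εdot .a .b .p)                = _ , ⇛-U a , ⇛-U a
  ⇛-diamond (⇛-app (⇛-ε _) (⇛-app (⇛-app (⇛-Πdot a b c p) x) y)) (⇛-εΠdot .a .b .c .p x' y')
    with ⇛-diamond x x' | ⇛-diamond y y'
  ... | _ , x₁ , x₂ | _ , y₁ , y₂ = _ , ⇛-εΠdot a b c p x₁ y₁ , ⇛-Πε a b x₂ y₂
  ⇛-diamond (⇛-εΠdot a b c p x y) (⇛-app (⇛-ε _) (⇛-app (⇛-app (⇛-Πdot .a .b .c .p) x') y'))
    with ⇛-diamond x x' | ⇛-diamond y y'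
  ... | _ , x₁ , x₂ | _ , y₁ , y₂ = _ , ⇛-Πε a b x₁ y₁ , ⇛-εΠdot a b c p x₂ y₂
  ⇛-diamond (⇛-εΠdot a b c p x y) (⇛-εΠdot .a .b .c .p x' y')
    with ⇛-diamond x x' | ⇛-diamond y y'
  ... | _ , x₁ , x₂ | _ , y₁ , y₂ = _ , ⇛-Πε a b x₁ y₁ , ⇛-Πε a b x₂ y₂

  ⟶⇒⇛ : _⟶_ ⇒ _⇛_
  ⟶⇒⇛ (β A M N)               = ⇛-β (⇛-refl M) (⇛-refl N)
  ⟶⇒⇛ (εdot s₁ s₂ p)          = ⇛-εdot s₁ s₂ p
  ⟶⇒⇛ (εΠdot s₁ s₂ s₃ p X Y)  = ⇛-εΠdot s₁ s₂ s₃ p (⇛-refl X) (⇛-refl Y)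
  ⟶⇒⇛ (Πˡ B r)                = ⇛-Π (⟶⇒⇛ r) (⇛-refl B)
  ⟶⇒⇛ (Πʳ A r)                = ⇛-Π (⇛-refl A) (⟶⇒⇛ r)
  ⟶⇒⇛ (lamˡ M r)              = ⇛-lam (⟶⇒⇛ r) (⇛-refl M)
  ⟶⇒⇛ (lamʳ A r)              = ⇛-lam (⇛-refl A) (⟶⇒⇛ r)
  ⟶⇒⇛ (appˡ N r)              = ⇛-app (⟶⇒⇛ r) (⇛-refl N)
  ⟶⇒⇛ (appʳ M r)              = ⇛-app (⇛-refl M) (⟶⇒⇛ r)

  ⟶*-cong₂ : ∀ (f : Term → Term → Term) →
             (∀ {M M'} N → M ⟶ M' → f M N ⟶ f M' N) →
             (∀ M {N N'} → N ⟶ N' → f M N ⟶ f M N') →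
             ∀ {M M' N N'} → M ⟶* M' → N ⟶* N' → f M N ⟶* f M' N'
  ⟶*-cong₂ f congˡ congʳ {M' = M'} {N = N} r s =
    gmap (λ t → f t N) (congˡ N) r ◅◅ gmap (f M') (congʳ M') s

  ⟶*-app : ∀ {M M' N N'} → M ⟶* M' → N ⟶* N' → app M N ⟶* app M' N'
  ⟶*-app = ⟶*-cong₂ app appˡ appʳ

  ⇛⇒⟶* : _⇛_ ⇒ _⟶*_
  ⇛⇒⟶* (⇛-var x)        = ◅-nil
  ⇛⇒⟶* ⇛-Type           = ◅-nil
  ⇛⇒⟶* ⇛-Kind           = ◅-nil
  ⇛⇒⟶* (⇛-U s)          = ◅-nil
  ⇛⇒⟶* (⇛-ε s)          = ◅-nil
  ⇛⇒⟶* (⇛-dot s₁ s₂ p)  = ◅-nil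
  ⇛⇒⟶* (⇛-Πdot a b c p) = ◅-nil
  ⇛⇒⟶* (⇛-Π a b)        = ⟶*-cong₂ Π Πˡ Πʳ (⇛⇒⟶* a) (⇛⇒⟶* b)
  ⇛⇒⟶* (⇛-lam a m)      = ⟶*-cong₂ lam lamˡ lamʳ (⇛⇒⟶* a) (⇛⇒⟶* m)
  ⇛⇒⟶* (⇛-app m n)      = ⟶*-app (⇛⇒⟶* m) (⇛⇒⟶* n)
  ⇛⇒⟶* (⇛-β {A = A} {M' = M'} {N' = N'} m n) =
    ⟶*-app (gmap (lam A) (lamʳ A) (⇛⇒⟶* m)) (⇛⇒⟶* n) ◅◅ return (β A M' N')
  ⇛⇒⟶* (⇛-εdot s₁ s₂ p) = return (εdot s₁ s₂ p)
  ⇛⇒⟶* (⇛-εΠdot s₁ s₂ s₃ p {X' = X'} {Y' = Y'} x y) =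
    gmap (app (ε s₃)) (appʳ (ε s₃))
      (⟶*-app (gmap (app (Πdot s₁ s₂ s₃ p)) (appʳ _) (⇛⇒⟶* x)) (⇛⇒⟶* y))
    ◅◅ return (εΠdot s₁ s₂ s₃ p X' Y')

  ⟶-confluent : Confluent _⟶_
  ⟶-confluent = confluent-via-diamond ⟶⇒⇛ ⇛⇒⟶* ⇛-diamond

proposition10 : (P : PTS) → Functional P →
    let open LambdaPi P in
    (M M' M'' : Term) → M ⟶* M' → M ⟶* M'' →
    Σ Term (λ N → (M' ⟶* N) × (M'' ⟶* N))
proposition10 P _ _ _ _ = Confluence.⟶-confluent P
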